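{- Let $G$ be a sesquicograph and let $e$ be an edge of $G$. Then $G/e$ is a sesquicograph.
   Context: All graphs are finite and simple. For vertex-disjoint graphs $G$ and $H$: the $0$-sum is their disjoint union; a $1$-sum is obtained from the disjoint union by identifying one vertex of $G$ with one vertex of $H$; the join is obtained from the disjoint union by adding all edges between $V(G)$ and $V(H)$. A sesquicograph is a graph that can be generated from the one-vertex graph $K_1$ using joins, $0$-sums and $1$-sums. For an edge $e$ of $G$, $G/e$ denotes the simple graph obtained by contracting $e$ and then keeping only one edge from each class of parallel edges (no loops). -}

module Defs where

open import Data.Nat using (ℕ; zero; suc; _+_)
open import Data.Fin using (Fin; splitAt; punchIn; _≟_)
open import Data.Bool using (Bool; true; false; _∧_; _∨_; not; if_then_else_)
open import Data.Bool.Properties using (∨-comm; ∨-assoc; ∧-comm)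
open import Data.Sum using (_⊎_; inj₁; inj₂)
open import Relation.Nullary using (does; yes; no)
open import Relation.Binary.PropositionalEquality
open import Function.Bundles using (_↔_; Inverse)

record Graph (n : ℕ) : Set where
  field
    adj   : Fin n → Fin n → Bool
    adj-sym : ∀ i j → adj i j ≡ adj j i
    adj-irr : ∀ i → adj i i ≡ false
open Graph public

record _≅_ {m n : ℕ} (G : Graph m) (H : Graph n) : Set where
  field
    bij  : Fin m ↔ Fin n
    pres : ∀ i j → adj G i j ≡ adj H (Inverse.to bij i) (Inverse.to bij j)

K₁ : Graph 1
K₁ = record { adj = λ _ _ → false ; adj-sym = λ _ _ → refl ; adj-irr = λ _ → refl }

adj⊎ : {m n : ℕ} → Bool → Graph m → Graph n → Fin m ⊎ Fin n → Fin m ⊎ Fin n → Bool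
adj⊎ c G H (inj₁ a) (inj₁ b) = adj G a b
adj⊎ c G H (inj₂ a) (inj₂ b) = adj H a b
adj⊎ c G H (inj₁ a) (inj₂ b) = c
adj⊎ c G H (inj₂ a) (inj₁ b) = c

adj⊎-sym : {m n : ℕ} (c : Bool) (G : Graph m) (H : Graph n) → ∀ x y → adj⊎ c G H x y ≡ adj⊎ c G H y x
adj⊎-sym c G H (inj₁ a) (inj₁ b) = adj-sym G a b
adj⊎-sym c G H (inj₂ a) (inj₂ b) = adj-sym H a b
adj⊎-sym c G H (inj₁ a) (inj₂ b) = refl
adj⊎-sym c G H (inj₂ a) (inj₁ b) = refl

adj⊎-irr : {m n : ℕ} (c : Bool) (G : Graph m) (H : Graph n) → ∀ x → adj⊎ c G H x x ≡ false
adj⊎-irr c G H (inj₁ a) = adj-irr G a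
adj⊎-irr c G H (inj₂ a) = adj-irr H a

_⊕_ : {m n : ℕ} → Graph m → Graph n → Graph (m + n)
_⊕_ {m} G H = record
  { adj = λ i j → adj⊎ false G H (splitAt m i) (splitAt m j)
  ; adj-sym = λ i j → adj⊎-sym false G H (splitAt m i) (splitAt m j)
  ; adj-irr = λ i → adj⊎-irr false G H (splitAt m i) }

join : {m n : ℕ} → Graph m → Graph n → Graph (m + n)
join {m} G H = record
  { adj = λ i j → adj⊎ true G H (splitAt m i) (splitAt m j)
  ; adj-sym = λ i j → adj⊎-sym true G H (splitAt m i) (splitAt m j)
  ; adj-irr = λ i → adj⊎-irr true G H (splitAt m i) }

-- 1-sum identifying vertex u of G with vertex v of H.
-- Vertex set Fin (suc m + n): the first suc m vertices are those of G (u plays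
-- the role of the identified vertex); the remaining n are the vertices of H other
-- than v, vertex k corresponding to punchIn v k.
adj1 : {m n : ℕ} → Graph (suc m) → Fin (suc m) → Graph (suc n) → Fin (suc n) →
       Fin (suc m) ⊎ Fin n → Fin (suc m) ⊎ Fin n → Bool
adj1 G u H v (inj₁ a) (inj₁ b) = adj G a b
adj1 G u H v (inj₂ k) (inj₂ l) = adj H (punchIn v k) (punchIn v l)
adj1 G u H v (inj₁ a) (inj₂ l) = does (a ≟ u) ∧ adj H v (punchIn v l)
adj1 G u H v (inj₂ k) (inj₁ b) = does (b ≟ u) ∧ adj H (punchIn v k) v

adj1-sym : {m n : ℕ} (G : Graph (suc m)) (u : Fin (suc m)) (H : Graph (suc n)) (v : Fin (suc n)) →
           ∀ x y → adj1 G u H v x y ≡ adj1 G u H v y x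
adj1-sym G u H v (inj₁ a) (inj₁ b) = adj-sym G a b
adj1-sym G u H v (inj₂ k) (inj₂ l) = adj-sym H (punchIn v k) (punchIn v l)
adj1-sym G u H v (inj₁ a) (inj₂ l) = cong (does (a ≟ u) ∧_) (adj-sym H v (punchIn v l))
adj1-sym G u H v (inj₂ k) (inj₁ b) = cong (does (b ≟ u) ∧_) (adj-sym H (punchIn v k) v)

adj1-irr : {m n : ℕ} (G : Graph (suc m)) (u : Fin (suc m)) (H : Graph (suc n)) (v : Fin (suc n)) →
           ∀ x → adj1 G u H v x x ≡ false
adj1-irr G u H v (inj₁ a) = adj-irr G a
adj1-irr G u H v (inj₂ k) = adj-irr H (punchIn v k)

oneSum : {m n : ℕ} → Graph (suc m) → Fin (suc m) → Graph (suc n) → Fin (suc n) → Graph (suc m + n)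
oneSum {m} G u H v = record
  { adj = λ i j → adj1 G u H v (splitAt (suc m) i) (splitAt (suc m) j)
  ; adj-sym = λ i j → adj1-sym G u H v (splitAt (suc m) i) (splitAt (suc m) j)
  ; adj-irr = λ i → adj1-irr G u H v (splitAt (suc m) i) }

data Sesqui : {n : ℕ} → Graph n → Set where
  k₁    : Sesqui K₁
  iso   : {m n : ℕ} {G : Graph m} {H : Graph n} → Sesqui G → G ≅ H → Sesqui H
  sum₀  : {m n : ℕ} {G : Graph m} {H : Graph n} → Sesqui G → Sesqui H → Sesqui (G ⊕ H)
  joinS : {m n : ℕ} {G : Graph m} {H : Graph n} → Sesqui G → Sesqui H → Sesqui (join G H)
  sum₁  : {m n : ℕ} {G : Graph (suc m)} {H : Graph (suc n)} (u : Fin (suc m)) (v : Fin (suc n)) →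
          Sesqui G → Sesqui H → Sesqui (oneSum G u H v)

-- Contraction G/e of the edge e = xy (simple graph: no loops, parallel edges merged).
-- Vertex set Fin n = vertices of G other than y (vertex a ↦ punchIn y a);
-- the contracted vertex is represented by x.
module _ {n : ℕ} (G : Graph (suc n)) (x y : Fin (suc n)) where
  private
    isx : Fin (suc n) → Bool
    isx a = does (a ≟ x)
    core : Fin n → Fin n → Bool
    core a b = adj G (punchIn y a) (punchIn y b)
             ∨ ((isx (punchIn y a) ∧ adj G y (punchIn y b))
             ∨ (isx (punchIn y b) ∧ adj G (punchIn y a) y))
    core-sym : ∀ a b → core a b ≡ core b a
    core-sym a b
      rewrite adj-sym G (punchIn y a) (punchIn y b)
            | adj-sym G y (punchIn y b) | adj-sym G (punchIn y a) y
            = cong (adj G (punchIn y b) (punchIn y a) ∨_)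
                (∨-comm (isx (punchIn y a) ∧ adj G (punchIn y b) y)
                        (isx (punchIn y b) ∧ adj G y (punchIn y a)))
    cadj : Fin n → Fin n → Bool
    cadj a b = if does (a ≟ b) then false else core a b
    cadj-sym : ∀ a b → cadj a b ≡ cadj b a
    cadj-sym a b with a ≟ b | b ≟ a
    ... | yes _ | yes _ = refl
    ... | yes p | no q = ⊥-elim' (q (sym p))
      where ⊥-elim' : _ → _
            ⊥-elim' ()
    ... | no q | yes p = ⊥-elim' (q (sym p))
      where ⊥-elim' : _ → _
            ⊥-elim' ()
    ... | no _ | no _ = core-sym a b
    cadj-irr : ∀ a → cadj a a ≡ false
    cadj-irr a with a ≟ a
    ... | yes _ = refl
    ... | no q = ⊥-elim' (q refl)
      where ⊥-elim' : _ → _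
            ⊥-elim' ()

  contract : Graph n
  contract = record { adj = cadj ; adj-sym = cadj-sym ; adj-irr = cadj-irr }

-- An edge inside one summand of a 0-sum, join or 1-sum (an
-- edge at the glued vertex of a 1-sum being an edge of the second summand) contracts to the same
-- operation applied to the contracted summand. The one new case is an edge xy across a join
-- G₁ ∨ G₂: every vertex sees x or y, so the merged vertex is universal and the contraction is
-- K₁ ∨ ((G₁ − x) ∨ (G₂ − y)). So we also show, by the same induction, that deleting a vertex of a
-- sesquicograph leaves a sesquicograph or the empty graph. As the class is closed only under
-- isomorphism, both inductions are about any graph K isomorphic to G/xy (resp. G − y) through a
-- Realisation.

module Submission where

open import Defs
open import Data.Nat using (ℕ; zero; suc; _+_)
open import Data.Nat.Properties using (+-suc; suc-injective; 1+n≰n)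
open import Data.Fin as Fin using (Fin; zero; suc; splitAt; punchIn; punchOut; _≟_; _↑ˡ_; _↑ʳ_)
open import Data.Fin.Properties
  using (any?; injective⇒≤; punchIn-injective; punchInᵢ≢i; punchIn-punchOut; punchOut-injective;
         splitAt-join; join-splitAt; splitAt-↑ˡ)
open import Data.Fin.Permutation using (Permutation; ↔⇒≡; _⟨$⟩ʳ_; _⟨$⟩ˡ_; inverseʳ)
open import Data.Fin.Permutation.Components using (transpose; transpose-inverse)
open import Data.Bool using (Bool; true; false; _∧_; _∨_)
open import Data.Bool.Properties using (∨-identityʳ; ∨-zeroʳ; ∨-comm; ∨-idem; ∧-zeroʳ; ∧-distribˡ-∨)
open import Data.Sum as Sum using (_⊎_; inj₁; inj₂)
open import Data.Sum.Properties using (≡-dec; inj₁-injective; inj₂-injective)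
open import Data.Product using (∃; _,_; proj₁; proj₂)
open import Function using (_∘_; id)
open import Function.Bundles using (mk↔ₛ′)
open import Function.Definitions using (Injective; StrictlySurjective)
open import Relation.Binary.Definitions using (DecidableEquality)
open import Relation.Binary.PropositionalEquality
open import Relation.Nullary using (does; yes; no; contradiction)
open import Relation.Nullary.Decidable using (dec-true; dec-false)

BoolRel : Set → Set
BoolRel V = V → V → Bool

injective⇒strictlySurjective : ∀ {n} {f : Fin n → Fin n} →
                               Injective _≡_ _≡_ f → StrictlySurjective _≡_ f
injective⇒strictlySurjective {suc n} {f} f-inj b with any? (λ a → f a ≟ b)
... | yes hit = hit
... | no miss = contradiction (injective⇒≤ {f = f-b} f-b-inj) 1+n≰n
  where
  f-b : Fin (suc n) → Fin n
  f-b a = punchOut {i = b} {j = f a} (λ b≡fa → miss (a , sym b≡fa))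
  f-b-inj : Injective _≡_ _≡_ f-b
  f-b-inj {a} {a′} = f-inj ∘ punchOut-injective (λ e → miss (a , sym e)) (λ e → miss (a′ , sym e))

does-≟-injective : ∀ {V W : Set} (_≟V_ : DecidableEquality V) (_≟W_ : DecidableEquality W)
                   {e : V → W} → Injective _≡_ _≡_ e → ∀ a b → does (e a ≟W e b) ≡ does (a ≟V b)
does-≟-injective _≟V_ _≟W_ {e} e-inj a b with a ≟V b
... | yes refl = dec-true (e a ≟W e a) refl
... | no a≢b = dec-false (e a ≟W e b) (a≢b ∘ e-inj)

punchIn-does-≟ : ∀ {n} (a : Fin (suc n)) {c u′ u} → punchIn a u′ ≡ u → does (punchIn a c ≟ u) ≡ does (c ≟ u′)
punchIn-does-≟ a {c} {u′} refl = does-≟-injective _≟_ _≟_ (punchIn-injective a _ _) c u′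

-- v′ is the index of v once w is deleted; ι translates the indices of the remaining vertices
-- into those obtained by deleting v first.
module PunchInPair {n : ℕ} {v w : Fin (suc (suc n))} (w≢v : w ≢ v) where

  v′ : Fin (suc n)
  v′ = punchOut w≢v

  punchIn-v′ : punchIn w v′ ≡ v
  punchIn-v′ = punchIn-punchOut w≢v

  private
    v≢punchIns : ∀ j → v ≢ punchIn w (punchIn v′ j)
    v≢punchIns j e = punchInᵢ≢i v′ j (sym (punchIn-injective w _ _ (trans punchIn-v′ e)))

  ι : Fin n → Fin (suc n)
  ι j = punchOut (v≢punchIns j)

  punchIn-ι : ∀ j → punchIn v (ι j) ≡ punchIn w (punchIn v′ j)
  punchIn-ι j = punchIn-punchOut (v≢punchIns j)

  ι-injective : Injective _≡_ _≡_ ι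
  ι-injective {j} {j′} e = punchIn-injective v′ _ _ (punchIn-injective w _ _
    (trans (sym (punchIn-ι j)) (trans (cong (punchIn v) e) (punchIn-ι j′))))

  punchIn-ι-avoids : ∀ j → punchIn v (ι j) ≢ w
  punchIn-ι-avoids j e = punchInᵢ≢i w (punchIn v′ j) (trans (sym (punchIn-ι j)) e)

module _ {n : ℕ} {i j : Fin n} where

  transpose-matchˡ : transpose i j i ≡ j
  transpose-matchˡ rewrite dec-true (i ≟ i) refl = refl

  transpose-matchʳ : j ≢ i → transpose i j j ≡ i
  transpose-matchʳ j≢i rewrite dec-false (j ≟ i) j≢i | dec-true (j ≟ j) refl = refl

  transpose-mismatch : ∀ {k} → k ≢ i → k ≢ j → transpose i j k ≡ k
  transpose-mismatch {k} k≢i k≢j rewrite dec-false (k ≟ i) k≢i | dec-false (k ≟ j) k≢j = refl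

∧-distribˡ-∨-∧ : ∀ d p q r → d ∧ (p ∨ (q ∧ r)) ≡ (d ∧ p) ∨ (q ∧ (d ∧ r))
∧-distribˡ-∨-∧ true p q r = refl
∧-distribˡ-∨-∧ false p q r = sym (∧-zeroʳ q)

does-≟-disjoint : ∀ {n} {c d : Fin n} (u : Fin n) (z : Bool) → c ≢ d → does (c ≟ u) ∧ (does (d ≟ u) ∧ z) ≡ false
does-≟-disjoint {c = c} {d} u z c≢d with c ≟ u | d ≟ u
... | yes refl | yes refl = contradiction refl c≢d
... | yes _ | no _ = refl
... | no _ | _ = refl

flip-≡ : ∀ {V : Set} {S T : BoolRel V} → (∀ a b → S a b ≡ S b a) → (∀ a b → T a b ≡ T b a) →
         ∀ a b → S a b ≡ T a b → S b a ≡ T b a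
flip-≡ S-sym T-sym a b e = trans (S-sym b a) (trans e (T-sym a b))

adjacent-≢ : ∀ {N} (G : Graph N) {x y : Fin N} → adj G x y ≡ true → x ≢ y
adjacent-≢ G {x} e refl = contradiction (trans (sym (adj-irr G x)) e) λ ()

-- The adjacency of G/xy, x standing for the merged vertex; meaningless at y and on the diagonal.
contractRel : {V : Set} → DecidableEquality V → BoolRel V → V → V → BoolRel V
contractRel _≟_ A x y u v = A u v ∨ ((does (u ≟ x) ∧ A y v) ∨ (does (v ≟ x) ∧ A u y))

contractAdj : ∀ {N} → Graph N → Fin N → Fin N → BoolRel (Fin N)
contractAdj G = contractRel _≟_ (adj G)

module _ {V : Set} (_≟_ : DecidableEquality V) (A : BoolRel V) (x y : V) where

  contractRel-merged : ∀ v → v ≢ x → contractRel _≟_ A x y x v ≡ A x v ∨ A y v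
  contractRel-merged v v≢x rewrite dec-true (x ≟ x) refl | dec-false (v ≟ x) v≢x =
    cong (A x v ∨_) (∨-identityʳ (A y v))

  contractRel-merged′ : ∀ u → u ≢ x → contractRel _≟_ A x y u x ≡ A u x ∨ A u y
  contractRel-merged′ u u≢x rewrite dec-true (x ≟ x) refl | dec-false (u ≟ x) u≢x = refl

  contractRel-unmerged : ∀ u v → u ≢ x → v ≢ x → contractRel _≟_ A x y u v ≡ A u v
  contractRel-unmerged u v u≢x v≢x rewrite dec-false (u ≟ x) u≢x | dec-false (v ≟ x) v≢x =
    ∨-identityʳ (A u v)

  contractRel-unmergedʳ : ∀ u v → v ≢ x → contractRel _≟_ A x y u v ≡ A u v ∨ (does (u ≟ x) ∧ A y v)
  contractRel-unmergedʳ u v v≢x rewrite dec-false (v ≟ x) v≢x =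
    cong (A u v ∨_) (∨-identityʳ (does (u ≟ x) ∧ A y v))

  contractRel-uniformˡ : ∀ u v {z} → v ≢ x → A x v ≡ z → A y v ≡ z → A u v ≡ z → contractRel _≟_ A x y u v ≡ z
  contractRel-uniformˡ u v {z} v≢x xv≡z yv≡z uv≡z with x ≟ u
  ... | yes refl = trans (contractRel-merged v v≢x) (trans (cong₂ _∨_ xv≡z yv≡z) (∨-idem z))
  ... | no x≢u = trans (contractRel-unmerged u v (x≢u ∘ sym) v≢x) uv≡z

  contractRel-sym : (∀ u v → A u v ≡ A v u) → ∀ u v → contractRel _≟_ A x y u v ≡ contractRel _≟_ A x y v u
  contractRel-sym A-sym u v rewrite A-sym u v | A-sym y v | A-sym u y =
    cong (A v u ∨_) (∨-comm (does (u ≟ x) ∧ A v y) (does (v ≟ x) ∧ A y u))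

contractRel-embed : ∀ {V W : Set} (_≟V_ : DecidableEquality V) (_≟W_ : DecidableEquality W)
                    {A : BoolRel V} {B : BoolRel W} {e : V → W} →
                    Injective _≡_ _≡_ e → (∀ u v → B (e u) (e v) ≡ A u v) →
                    ∀ x y u v → contractRel _≟W_ B (e x) (e y) (e u) (e v) ≡ contractRel _≟V_ A x y u v
contractRel-embed _≟V_ _≟W_ e-inj B≡A x y u v
  rewrite B≡A u v | B≡A y v | B≡A u y
        | does-≟-injective _≟V_ _≟W_ e-inj u x | does-≟-injective _≟V_ _≟W_ e-inj v x = refl

-- The vertex of G that represents u in G/xy: y is represented by x.
merge : ∀ {n} → Fin n → Fin n → Fin n → Fin n
merge x y u with y ≟ u
... | yes _ = x
... | no _ = u

merge-≢ : ∀ {n} {x y u : Fin n} → x ≢ y → y ≢ merge x y u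
merge-≢ {x = x} {y} {u} x≢y with y ≟ u
... | yes _ = x≢y ∘ sym
... | no y≢u = y≢u

-- A vertex adjacent only to u is, in G/xy, adjacent only to the class of u.
merge-neighbour : ∀ {n} {x y u w : Fin n} (h : Bool) → w ≢ y →
                  (does (w ≟ u) ∧ h) ∨ (does (w ≟ x) ∧ (does (y ≟ u) ∧ h)) ≡ does (w ≟ merge x y u) ∧ h
merge-neighbour {x = x} {y} {u} {w} h w≢y with y ≟ u
... | yes refl rewrite dec-false (w ≟ y) w≢y = refl
... | no _ rewrite ∧-zeroʳ (does (w ≟ x)) = ∨-identityʳ _

-- A realisation identifies K with the graph that R induces on the vertices other than y.
record Realisation {N k : ℕ} (R : BoolRel (Fin N)) (y : Fin N) (K : Graph k) : Set where
  field
    embed     : Fin k → Fin N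
    size      : suc k ≡ N
    injective : Injective _≡_ _≡_ embed
    avoids    : ∀ a → embed a ≢ y
    adj-embed : ∀ a b → a ≢ b → adj K a b ≡ R (embed a) (embed b)
open Realisation

module _ {N k : ℕ} {R : BoolRel (Fin N)} {y : Fin N} {K : Graph k} where

  realisation-onto : (r : Realisation R y K) → ∀ w → w ≢ y → ∃ λ a → embed r a ≡ w
  realisation-onto r@record { embed = φ ; size = refl } w w≢y = a , (begin
      φ a                              ≡⟨ punchIn-punchOut (avoids r a ∘ sym) ⟨
      punchIn y (φ′ a)                 ≡⟨ cong (punchIn y) φ′a≡w′ ⟩
      punchIn y (punchOut (w≢y ∘ sym)) ≡⟨ punchIn-punchOut (w≢y ∘ sym) ⟩
      w                                ∎)
    where
    open ≡-Reasoning
    φ′ : Fin k → Fin k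
    φ′ a = punchOut {i = y} {j = φ a} (avoids r a ∘ sym)
    φ′-inj : Injective _≡_ _≡_ φ′
    φ′-inj {a} {b} = injective r ∘ punchOut-injective (avoids r a ∘ sym) (avoids r b ∘ sym)
    a : Fin k
    a = proj₁ (injective⇒strictlySurjective φ′-inj (punchOut (w≢y ∘ sym)))
    φ′a≡w′ : φ′ a ≡ punchOut (w≢y ∘ sym)
    φ′a≡w′ = proj₂ (injective⇒strictlySurjective φ′-inj (punchOut (w≢y ∘ sym)))

realisation-≅ : ∀ {N t k} {R : BoolRel (Fin N)} {y : Fin N} {T : Graph t} {K : Graph k} →
                Realisation R y T → Realisation R y K → T ≅ K
realisation-≅ {N} {t} {k} {R} {T = T} {K} rT rK = record { bij = mk↔ₛ′ to from to-from from-to ; pres = pres }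
  where
  open ≡-Reasoning
  ψ : Fin t → Fin N
  ψ = embed rT
  φ : Fin k → Fin N
  φ = embed rK
  to : Fin t → Fin k
  to a = proj₁ (realisation-onto rK (ψ a) (avoids rT a))
  from : Fin k → Fin t
  from b = proj₁ (realisation-onto rT (φ b) (avoids rK b))
  φ-to : ∀ a → φ (to a) ≡ ψ a
  φ-to a = proj₂ (realisation-onto rK (ψ a) (avoids rT a))
  ψ-from : ∀ b → ψ (from b) ≡ φ b
  ψ-from b = proj₂ (realisation-onto rT (φ b) (avoids rK b))
  to-from : ∀ b → to (from b) ≡ b
  to-from b = injective rK (trans (φ-to (from b)) (ψ-from b))
  from-to : ∀ a → from (to a) ≡ a
  from-to a = injective rT (trans (ψ-from (to a)) (φ-to a))
  pres : ∀ a b → adj T a b ≡ adj K (to a) (to b)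
  pres a b with a ≟ b
  ... | yes refl = trans (adj-irr T a) (sym (adj-irr K (to a)))
  ... | no a≢b = begin
    adj T a b                ≡⟨ adj-embed rT a b a≢b ⟩
    R (ψ a) (ψ b)            ≡⟨ cong₂ R (φ-to a) (φ-to b) ⟨
    R (φ (to a)) (φ (to b))  ≡⟨ adj-embed rK (to a) (to b) (a≢b ∘ to-injective) ⟨
    adj K (to a) (to b)      ∎
    where
    to-injective : to a ≡ to b → a ≡ b
    to-injective e = trans (sym (from-to a)) (trans (cong from e) (from-to b))

realisation-Sesqui : ∀ {N t k} {R : BoolRel (Fin N)} {y : Fin N} {T : Graph t} {K : Graph k} →
                     Sesqui T → Realisation R y T → Realisation R y K → Sesqui K
realisation-Sesqui sT rT rK = iso sT (realisation-≅ rT rK)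

realisation-pullback : ∀ {N N′ k} {R : BoolRel (Fin N)} {R′ : BoolRel (Fin N′)} {y : Fin N}
                       {K : Graph k} (g : Fin N → Fin N′) → Injective _≡_ _≡_ g → N ≡ N′ →
                       (∀ u v → u ≢ y → v ≢ y → u ≢ v → R′ (g u) (g v) ≡ R u v) →
                       Realisation R y K → Realisation R′ (g y) K
realisation-pullback g g-inj N≡N′ R′≡R r = record
  { embed = g ∘ embed r
  ; size = trans (size r) N≡N′
  ; injective = injective r ∘ g-inj
  ; avoids = λ a → avoids r a ∘ g-inj
  ; adj-embed = λ a b a≢b → trans (adj-embed r a b a≢b)
      (sym (R′≡R _ _ (avoids r a) (avoids r b) (a≢b ∘ injective r)))
  }

module _ {N′ N : ℕ} {G′ : Graph N′} {G : Graph N} (G′≅G : G′ ≅ G) where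
  private
    π : Permutation N′ N
    π = _≅_.bij G′≅G
    g : Fin N → Fin N′
    g = π ⟨$⟩ˡ_
    g-inj : Injective _≡_ _≡_ g
    g-inj e = trans (sym (inverseʳ π)) (trans (cong (π ⟨$⟩ʳ_) e) (inverseʳ π))
    adj-g : ∀ u v → adj G′ (g u) (g v) ≡ adj G u v
    adj-g u v = trans (_≅_.pres G′≅G (g u) (g v)) (cong₂ (adj G) (inverseʳ π) (inverseʳ π))
    N≡N′ : N ≡ N′
    N≡N′ = sym (↔⇒≡ π)

  ≅-adj : ∀ {x y} → adj G x y ≡ true → adj G′ (g x) (g y) ≡ true
  ≅-adj {x} {y} = trans (adj-g x y)

  ≅-realisation-delete : ∀ {y k} {K : Graph k} → Realisation (adj G) y K → Realisation (adj G′) (g y) K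
  ≅-realisation-delete = realisation-pullback g g-inj N≡N′ (λ u v _ _ _ → adj-g u v)

  ≅-realisation-contract : ∀ {x y k} {K : Graph k} → Realisation (contractAdj G x y) y K →
                           Realisation (contractAdj G′ (g x) (g y)) (g y) K
  ≅-realisation-contract {x} {y} = realisation-pullback g g-inj N≡N′
    (λ u v _ _ _ → contractRel-embed _≟_ _≟_ {B = adj G′} g-inj adj-g x y u v)

contract-realisation : ∀ {n} (G : Graph (suc n)) (x y : Fin (suc n)) →
                       Realisation (contractAdj G x y) y (contract G x y)
contract-realisation G x y = record
  { embed = punchIn y
  ; size = refl
  ; injective = punchIn-injective y _ _
  ; avoids = punchInᵢ≢i y
  ; adj-embed = adj-contract
  }
  where
  adj-contract : ∀ a b → a ≢ b → adj (contract G x y) a b ≡ contractAdj G x y (punchIn y a) (punchIn y b)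
  adj-contract a b a≢b with a ≟ b
  ... | yes a≡b = contradiction a≡b a≢b
  ... | no _ = refl

contract-embed : ∀ {n} {W : Set} (_≟W_ : DecidableEquality W) (G : Graph (suc n)) (x y : Fin (suc n))
                 {B : BoolRel W} {e : Fin (suc n) → W} →
                 Injective _≡_ _≡_ e → (∀ u v → B (e u) (e v) ≡ adj G u v) →
                 ∀ a b → a ≢ b →
                 adj (contract G x y) a b ≡ contractRel _≟W_ B (e x) (e y) (e (punchIn y a)) (e (punchIn y b))
contract-embed _≟W_ G x y {B} e-inj B≡adj a b a≢b = trans (adj-embed (contract-realisation G x y) a b a≢b)
  (sym (contractRel-embed _≟_ _≟W_ {B = B} e-inj B≡adj x y _ _))

contract-swap : ∀ {N k} (G : Graph N) {x y : Fin N} {K : Graph k} → x ≢ y →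
                Realisation (contractAdj G x y) y K → Realisation (contractAdj G y x) x K
contract-swap {N} G {x} {y} {K} x≢y r =
  subst (λ z → Realisation (contractAdj G y x) z K) (transpose-matchʳ (x≢y ∘ sym))
    (realisation-pullback τ τ-injective refl contractAdj-τ r)
  where
  open ≡-Reasoning
  A : BoolRel (Fin N)
  A = adj G
  τ : Fin N → Fin N
  τ = transpose x y
  τ-injective : Injective _≡_ _≡_ τ
  τ-injective e = trans (sym (transpose-inverse y x)) (trans (cong (transpose y x) e) (transpose-inverse y x))
  contractAdj-τ : ∀ u v → u ≢ y → v ≢ y → u ≢ v → contractAdj G y x (τ u) (τ v) ≡ contractAdj G x y u v
  contractAdj-τ u v u≢y v≢y u≢v with x ≟ u | x ≟ v
  ... | yes refl | yes refl = contradiction refl u≢v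
  ... | yes refl | no x≢v = begin
    contractAdj G y x (τ x) (τ v)
      ≡⟨ cong₂ (contractAdj G y x) (transpose-matchˡ {i = x}) (transpose-mismatch (x≢v ∘ sym) v≢y) ⟩
    contractAdj G y x y v         ≡⟨ contractRel-merged _≟_ A y x v v≢y ⟩
    A y v ∨ A x v                 ≡⟨ ∨-comm (A y v) (A x v) ⟩
    A x v ∨ A y v                 ≡⟨ contractRel-merged _≟_ A x y v (x≢v ∘ sym) ⟨
    contractAdj G x y x v         ∎
  ... | no x≢u | yes refl = begin
    contractAdj G y x (τ u) (τ x)
      ≡⟨ cong₂ (contractAdj G y x) (transpose-mismatch (x≢u ∘ sym) u≢y) (transpose-matchˡ {i = x}) ⟩
    contractAdj G y x u y         ≡⟨ contractRel-merged′ _≟_ A y x u u≢y ⟩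
    A u y ∨ A u x                 ≡⟨ ∨-comm (A u y) (A u x) ⟩
    A u x ∨ A u y                 ≡⟨ contractRel-merged′ _≟_ A x y u (x≢u ∘ sym) ⟨
    contractAdj G x y u x         ∎
  ... | no x≢u | no x≢v = begin
    contractAdj G y x (τ u) (τ v)
      ≡⟨ cong₂ (contractAdj G y x) (transpose-mismatch (x≢u ∘ sym) u≢y) (transpose-mismatch (x≢v ∘ sym) v≢y) ⟩
    contractAdj G y x u v         ≡⟨ contractRel-unmerged _≟_ A y x u v u≢y v≢y ⟩
    A u v                         ≡⟨ contractRel-unmerged _≟_ A x y u v (x≢u ∘ sym) (x≢v ∘ sym) ⟨
    contractAdj G x y u v         ∎

delete : ∀ {n} → Graph (suc n) → Fin (suc n) → Graph n
delete G y = record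
  { adj = λ a b → adj G (punchIn y a) (punchIn y b)
  ; adj-sym = λ a b → adj-sym G (punchIn y a) (punchIn y b)
  ; adj-irr = λ a → adj-irr G (punchIn y a)
  }

delete-realisation : ∀ {n} (G : Graph (suc n)) (y : Fin (suc n)) → Realisation (adj G) y (delete G y)
delete-realisation G y = record
  { embed = punchIn y
  ; size = refl
  ; injective = punchIn-injective y _ _
  ; avoids = punchInᵢ≢i y
  ; adj-embed = λ _ _ _ → refl
  }

infix 4 _≟⊎_
_≟⊎_ : ∀ {m n} → DecidableEquality (Fin m ⊎ Fin n)
_≟⊎_ = ≡-dec _≟_ _≟_

join-injective : ∀ m n → Injective _≡_ _≡_ (Fin.join m n)
join-injective m n {r} {s} e = trans (sym (splitAt-join m n r)) (trans (cong (splitAt m) e) (splitAt-join m n s))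

splitAt-injective : ∀ m n → Injective _≡_ _≡_ (splitAt m {n})
splitAt-injective m n {i} {j} e = trans (sym (join-splitAt m n i)) (trans (cong (Fin.join m n) e) (join-splitAt m n j))

⊎-map-injective : ∀ {A B C D : Set} {f : A → C} {g : B → D} →
                  Injective _≡_ _≡_ f → Injective _≡_ _≡_ g → Injective _≡_ _≡_ (Sum.map f g)
⊎-map-injective f-inj g-inj {inj₁ _} {inj₁ _} e = cong inj₁ (f-inj (inj₁-injective e))
⊎-map-injective f-inj g-inj {inj₂ _} {inj₂ _} e = cong inj₂ (g-inj (inj₂-injective e))
⊎-map-injective f-inj g-inj {inj₁ _} {inj₂ _} ()
⊎-map-injective f-inj g-inj {inj₂ _} {inj₁ _} ()

module _ {A B C D : Set} {f : A → C} {g : B → D} where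

  ⊎-map-avoids₁ : ∀ {y} → (∀ a → f a ≢ y) → ∀ r → Sum.map f g r ≢ inj₁ y
  ⊎-map-avoids₁ f-avoids (inj₁ a) = f-avoids a ∘ inj₁-injective
  ⊎-map-avoids₁ f-avoids (inj₂ b) ()

  ⊎-map-avoids₂ : ∀ {y} → (∀ b → g b ≢ y) → ∀ r → Sum.map f g r ≢ inj₂ y
  ⊎-map-avoids₂ g-avoids (inj₁ a) ()
  ⊎-map-avoids₂ g-avoids (inj₂ b) = g-avoids b ∘ inj₂-injective

data SplitView : (m n : ℕ) → Fin (m + n) → Set where
  left  : ∀ {m n} (a : Fin (suc m)) → SplitView (suc m) n (a ↑ˡ n)
  right : ∀ {m n} (b : Fin (suc n)) → SplitView m (suc n) (m ↑ʳ b)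

splitView : ∀ m n i → SplitView m n i
splitView m n i = subst (SplitView m n) (join-splitAt m n i) (view (splitAt m i))
  where
  view : ∀ {m n} (r : Fin m ⊎ Fin n) → SplitView m n (Fin.join m n r)
  view {suc m} (inj₁ a) = left a
  view {n = suc n} (inj₂ b) = right b

realisation-via-sums :
  ∀ {t₁ t₂ M₁ M₂} {T : Graph (t₁ + t₂)} {R : BoolRel (Fin (M₁ + M₂))}
  (S : BoolRel (Fin t₁ ⊎ Fin t₂)) (Q : BoolRel (Fin M₁ ⊎ Fin M₂))
  {Y : Fin M₁ ⊎ Fin M₂} (f : Fin t₁ ⊎ Fin t₂ → Fin M₁ ⊎ Fin M₂) →
  (∀ p q → adj T p q ≡ S (splitAt t₁ p) (splitAt t₁ q)) →
  (∀ r s → R (Fin.join M₁ M₂ r) (Fin.join M₁ M₂ s) ≡ Q r s) →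
  suc (t₁ + t₂) ≡ M₁ + M₂ → Injective _≡_ _≡_ f → (∀ r → f r ≢ Y) →
  (∀ r s → r ≢ s → S r s ≡ Q (f r) (f s)) →
  Realisation R (Fin.join M₁ M₂ Y) T
realisation-via-sums {t₁} {t₂} {M₁} {M₂} S Q f adj-T R≡Q sizes f-inj f-avoids S≡Q = record
  { embed = Fin.join M₁ M₂ ∘ f ∘ splitAt t₁
  ; size = sizes
  ; injective = splitAt-injective t₁ t₂ ∘ f-inj ∘ join-injective M₁ M₂
  ; avoids = λ p → f-avoids (splitAt t₁ p) ∘ join-injective M₁ M₂
  ; adj-embed = λ p q p≢q → trans (adj-T p q)
      (trans (S≡Q (splitAt t₁ p) (splitAt t₁ q) (p≢q ∘ splitAt-injective t₁ t₂)) (sym (R≡Q _ _)))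
  }

module _ {M₁ M₂ : ℕ} {G : Graph (M₁ + M₂)} (A : BoolRel (Fin M₁ ⊎ Fin M₂))
         (adj-G : ∀ i j → adj G i j ≡ A (splitAt M₁ i) (splitAt M₁ j)) where

  adj-join : ∀ r s → adj G (Fin.join M₁ M₂ r) (Fin.join M₁ M₂ s) ≡ A r s
  adj-join r s = trans (adj-G _ _) (cong₂ A (splitAt-join M₁ M₂ r) (splitAt-join M₁ M₂ s))

  contractAdj-join : ∀ X Y r s →
    contractAdj G (Fin.join M₁ M₂ X) (Fin.join M₁ M₂ Y) (Fin.join M₁ M₂ r) (Fin.join M₁ M₂ s) ≡
    contractRel _≟⊎_ A X Y r s
  contractAdj-join = contractRel-embed _≟⊎_ _≟_ {B = adj G} (join-injective M₁ M₂) adj-join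

-- G ⊕⟨ false ⟩ H is G ⊕ H and G ⊕⟨ true ⟩ H is join G H, definitionally.
infix 25 _⊕⟨_⟩_
_⊕⟨_⟩_ : ∀ {m n} → Graph m → Bool → Graph n → Graph (m + n)
_⊕⟨_⟩_ {m} G c H = record
  { adj = λ i j → adj⊎ c G H (splitAt m i) (splitAt m j)
  ; adj-sym = λ i j → adj⊎-sym c G H (splitAt m i) (splitAt m j)
  ; adj-irr = λ i → adj⊎-irr c G H (splitAt m i)
  }

Sesqui-⊕⟨⟩ : ∀ c {m n} {G : Graph m} {H : Graph n} → Sesqui G → Sesqui H → Sesqui (G ⊕⟨ c ⟩ H)
Sesqui-⊕⟨⟩ false = sum₀
Sesqui-⊕⟨⟩ true = joinS

module _ (c : Bool) {m n : ℕ} (G : Graph m) (H : Graph n) where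

  ⊕⟨⟩-adj-join : ∀ r s → adj (G ⊕⟨ c ⟩ H) (Fin.join m n r) (Fin.join m n s) ≡ adj⊎ c G H r s
  ⊕⟨⟩-adj-join = adj-join {G = G ⊕⟨ c ⟩ H} (adj⊎ c G H) (λ _ _ → refl)

  ⊕⟨⟩-edge : ∀ r s → adj (G ⊕⟨ c ⟩ H) (Fin.join m n r) (Fin.join m n s) ≡ true → adj⊎ c G H r s ≡ true
  ⊕⟨⟩-edge r s = trans (sym (⊕⟨⟩-adj-join r s))

  ⊕⟨⟩-contractAdj-join : ∀ X Y r s →
    contractAdj (G ⊕⟨ c ⟩ H) (Fin.join m n X) (Fin.join m n Y) (Fin.join m n r) (Fin.join m n s) ≡
    contractRel _≟⊎_ (adj⊎ c G H) X Y r s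
  ⊕⟨⟩-contractAdj-join = contractAdj-join {G = G ⊕⟨ c ⟩ H} (adj⊎ c G H) (λ _ _ → refl)

module _ {m n : ℕ} (G : Graph (suc m)) (u : Fin (suc m)) (H : Graph (suc n)) (v : Fin (suc n)) where

  oneSum-adj-join : ∀ r s → adj (oneSum G u H v) (Fin.join (suc m) n r) (Fin.join (suc m) n s) ≡ adj1 G u H v r s
  oneSum-adj-join = adj-join {G = oneSum G u H v} (adj1 G u H v) (λ _ _ → refl)

  oneSum-edge : ∀ r s → adj (oneSum G u H v) (Fin.join (suc m) n r) (Fin.join (suc m) n s) ≡ true →
                adj1 G u H v r s ≡ true
  oneSum-edge r s = trans (sym (oneSum-adj-join r s))

  oneSum-contractAdj-join : ∀ X Y r s →
    contractAdj (oneSum G u H v) (Fin.join (suc m) n X) (Fin.join (suc m) n Y) (Fin.join (suc m) n r) (Fin.join (suc m) n s) ≡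
    contractRel _≟⊎_ (adj1 G u H v) X Y r s
  oneSum-contractAdj-join = contractAdj-join {G = oneSum G u H v} (adj1 G u H v) (λ _ _ → refl)

adj⊎-map : ∀ c {m′ n′ m n} {G′ : Graph m′} {H′ : Graph n′} {G : Graph m} {H : Graph n}
           {f : Fin m′ → Fin m} {g : Fin n′ → Fin n} →
           (∀ a b → adj G′ a b ≡ adj G (f a) (f b)) → (∀ a b → adj H′ a b ≡ adj H (g a) (g b)) →
           ∀ r s → adj⊎ c G′ H′ r s ≡ adj⊎ c G H (Sum.map f g r) (Sum.map f g s)
adj⊎-map c adj-f adj-g (inj₁ a) (inj₁ b) = adj-f a b
adj⊎-map c adj-f adj-g (inj₁ a) (inj₂ b) = refl
adj⊎-map c adj-f adj-g (inj₂ a) (inj₁ b) = refl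
adj⊎-map c adj-f adj-g (inj₂ a) (inj₂ b) = adj-g a b

-- Deleting a vertex

module _ (c : Bool) {m n : ℕ} where

  ⊕⟨⟩-delete-left : (G : Graph (suc m)) (H : Graph n) (a : Fin (suc m)) →
                    Realisation (adj (G ⊕⟨ c ⟩ H)) (a ↑ˡ n) (delete G a ⊕⟨ c ⟩ H)
  ⊕⟨⟩-delete-left G H a = realisation-via-sums (adj⊎ c (delete G a) H) (adj⊎ c G H) (Sum.map (punchIn a) id)
    (λ _ _ → refl) (⊕⟨⟩-adj-join c G H) refl
    (⊎-map-injective (punchIn-injective a _ _) id) (⊎-map-avoids₁ (punchInᵢ≢i a))
    (λ r s _ → adj⊎-map c (λ _ _ → refl) (λ _ _ → refl) r s)

  ⊕⟨⟩-delete-right : (G : Graph m) (H : Graph (suc n)) (b : Fin (suc n)) →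
                     Realisation (adj (G ⊕⟨ c ⟩ H)) (m ↑ʳ b) (G ⊕⟨ c ⟩ delete H b)
  ⊕⟨⟩-delete-right G H b = realisation-via-sums (adj⊎ c G (delete H b)) (adj⊎ c G H) (Sum.map id (punchIn b))
    (λ _ _ → refl) (⊕⟨⟩-adj-join c G H) (sym (+-suc m n))
    (⊎-map-injective id (punchIn-injective b _ _)) (⊎-map-avoids₂ (punchInᵢ≢i b))
    (λ r s _ → adj⊎-map c (λ _ _ → refl) (λ _ _ → refl) r s)

module _ {m n : ℕ} where

  oneSum-delete-glued : (G : Graph (suc m)) (u : Fin (suc m)) (H : Graph (suc n)) (v : Fin (suc n)) →
                        Realisation (adj (oneSum G u H v)) (u ↑ˡ n) (delete G u ⊕ delete H v)
  oneSum-delete-glued G u H v = realisation-via-sums (adj⊎ false (delete G u) (delete H v)) (adj1 G u H v)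
    (Sum.map (punchIn u) id) (λ _ _ → refl) (oneSum-adj-join G u H v) refl
    (⊎-map-injective (punchIn-injective u _ _) id) (⊎-map-avoids₁ (punchInᵢ≢i u)) glued
    where
    not-glued : ∀ a h → false ≡ does (punchIn u a ≟ u) ∧ h
    not-glued a h = sym (cong (_∧ h) (dec-false (punchIn u a ≟ u) (punchInᵢ≢i u a)))
    glued : ∀ r s → r ≢ s → adj⊎ false (delete G u) (delete H v) r s ≡
                            adj1 G u H v (Sum.map (punchIn u) id r) (Sum.map (punchIn u) id s)
    glued (inj₁ a) (inj₁ b) _ = refl
    glued (inj₁ a) (inj₂ l) _ = not-glued a _
    glued (inj₂ l) (inj₁ b) _ = not-glued b _
    glued (inj₂ k) (inj₂ l) _ = refl

  oneSum-delete-left : (G : Graph (suc (suc m))) (u : Fin (suc (suc m))) (H : Graph (suc n)) (v : Fin (suc n)) →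
                       (a : Fin (suc (suc m))) (a≢u : a ≢ u) →
                       Realisation (adj (oneSum G u H v)) (a ↑ˡ n) (oneSum (delete G a) (punchOut a≢u) H v)
  oneSum-delete-left G u H v a a≢u = realisation-via-sums
    (adj1 (delete G a) (punchOut a≢u) H v) (adj1 G u H v)
    (Sum.map (punchIn a) id) (λ _ _ → refl) (oneSum-adj-join G u H v) refl
    (⊎-map-injective (punchIn-injective a _ _) id) (⊎-map-avoids₁ (punchInᵢ≢i a)) formula
    where
    does-u : ∀ c → does (c ≟ punchOut a≢u) ≡ does (punchIn a c ≟ u)
    does-u c = sym (punchIn-does-≟ a (punchIn-punchOut a≢u))
    formula : ∀ r s → r ≢ s → adj1 (delete G a) (punchOut a≢u) H v r s ≡
                              adj1 G u H v (Sum.map (punchIn a) id r) (Sum.map (punchIn a) id s)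
    formula (inj₁ c) (inj₁ d) _ = refl
    formula (inj₁ c) (inj₂ l) _ = cong (_∧ _) (does-u c)
    formula (inj₂ l) (inj₁ d) _ = cong (_∧ _) (does-u d)
    formula (inj₂ k) (inj₂ l) _ = refl

module _ {m n : ℕ} (G : Graph (suc m)) (u : Fin (suc m)) (H : Graph (suc (suc n))) (v : Fin (suc (suc n)))
         (l : Fin (suc n)) where
  open PunchInPair (punchInᵢ≢i v l)

  oneSum-delete-right : Realisation (adj (oneSum G u H v)) (suc m ↑ʳ l) (oneSum G u (delete H (punchIn v l)) v′)
  oneSum-delete-right = realisation-via-sums
    (adj1 G u (delete H (punchIn v l)) v′) (adj1 G u H v)
    (Sum.map id ι) (λ _ _ → refl) (oneSum-adj-join G u H v)
    (sym (+-suc (suc m) n)) (⊎-map-injective id ι-injective)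
    (⊎-map-avoids₂ (λ j → punchIn-ι-avoids j ∘ cong (punchIn v))) formula
    where
    formula : ∀ r s → r ≢ s → adj1 G u (delete H (punchIn v l)) v′ r s ≡
                              adj1 G u H v (Sum.map id ι r) (Sum.map id ι s)
    formula (inj₁ c) (inj₁ d) _ = refl
    formula (inj₁ c) (inj₂ j) _ = cong (does (c ≟ u) ∧_) (cong₂ (adj H) punchIn-v′ (sym (punchIn-ι j)))
    formula (inj₂ j) (inj₁ d) _ = cong (does (d ≟ u) ∧_) (cong₂ (adj H) (sym (punchIn-ι j)) punchIn-v′)
    formula (inj₂ j) (inj₂ j′) _ = cong₂ (adj H) (sym (punchIn-ι j)) (sym (punchIn-ι j′))

SesquiOrEmpty : ∀ {k} → Graph k → Set
SesquiOrEmpty {k} K = k ≡ 0 ⊎ Sesqui K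

nonempty-Sesqui : ∀ {k} {K : Graph (suc k)} → SesquiOrEmpty K → Sesqui K
nonempty-Sesqui (inj₂ s) = s

SesquiOrEmpty-≅ : ∀ {t k} {T : Graph t} {K : Graph k} → SesquiOrEmpty T → T ≅ K → SesquiOrEmpty K
SesquiOrEmpty-≅ (inj₁ refl) T≅K = inj₁ (sym (↔⇒≡ (_≅_.bij T≅K)))
SesquiOrEmpty-≅ (inj₂ s) T≅K = inj₂ (iso s T≅K)

realisation-SesquiOrEmpty : ∀ {N t k} {R : BoolRel (Fin N)} {y : Fin N} {T : Graph t} {K : Graph k} →
                            SesquiOrEmpty T → Realisation R y T → Realisation R y K → SesquiOrEmpty K
realisation-SesquiOrEmpty sT rT rK = SesquiOrEmpty-≅ sT (realisation-≅ rT rK)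

module _ (c : Bool) where

  ⊕⟨⟩-emptyˡ : ∀ {n} (G : Graph 0) (H : Graph n) → H ≅ G ⊕⟨ c ⟩ H
  ⊕⟨⟩-emptyˡ G H = record { bij = mk↔ₛ′ id id (λ _ → refl) (λ _ → refl) ; pres = λ _ _ → refl }

  ⊕⟨⟩-emptyʳ : ∀ {m} (G : Graph m) (H : Graph 0) → G ≅ G ⊕⟨ c ⟩ H
  ⊕⟨⟩-emptyʳ {m} G H = record { bij = mk↔ₛ′ (_↑ˡ 0) from to-from from-to ; pres = pres }
    where
    from : Fin (m + 0) → Fin m
    from i = Sum.fromInj₁ (λ ()) (splitAt m i)
    to-from : ∀ i → from i ↑ˡ 0 ≡ i
    to-from i with splitAt m i in eq
    ... | inj₁ a = trans (cong (Fin.join m 0) (sym eq)) (join-splitAt m 0 i)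
    from-to : ∀ a → from (a ↑ˡ 0) ≡ a
    from-to a rewrite splitAt-↑ˡ m a 0 = refl
    pres : ∀ a b → adj G a b ≡ adj (G ⊕⟨ c ⟩ H) (a ↑ˡ 0) (b ↑ˡ 0)
    pres a b rewrite splitAt-↑ˡ m a 0 | splitAt-↑ˡ m b 0 = refl

  ⊕⟨⟩-SesquiOrEmpty : ∀ {m n} {G : Graph m} {H : Graph n} →
                      SesquiOrEmpty G → SesquiOrEmpty H → SesquiOrEmpty (G ⊕⟨ c ⟩ H)
  ⊕⟨⟩-SesquiOrEmpty {G = G} {H} (inj₁ refl) sH = SesquiOrEmpty-≅ sH (⊕⟨⟩-emptyˡ G H)
  ⊕⟨⟩-SesquiOrEmpty {G = G} {H} (inj₂ sG) (inj₁ refl) = inj₂ (iso sG (⊕⟨⟩-emptyʳ G H))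
  ⊕⟨⟩-SesquiOrEmpty (inj₂ sG) (inj₂ sH) = inj₂ (Sesqui-⊕⟨⟩ c sG sH)

DeletionClosed : ∀ {N} → Graph N → Set
DeletionClosed {N} G = ∀ {y : Fin N} {k} {K : Graph k} → Realisation (adj G) y K → SesquiOrEmpty K

⊕⟨⟩-deletionClosed : ∀ c {m n} {G : Graph m} {H : Graph n} → Sesqui G → Sesqui H →
                     DeletionClosed G → DeletionClosed H →
                     ∀ {y k} {K : Graph k} → SplitView m n y → Realisation (adj (G ⊕⟨ c ⟩ H)) y K → SesquiOrEmpty K
⊕⟨⟩-deletionClosed c {G = G} {H} sG sH delG delH (left a) =
  realisation-SesquiOrEmpty (⊕⟨⟩-SesquiOrEmpty c (delG (delete-realisation G a)) (inj₂ sH)) (⊕⟨⟩-delete-left c G H a)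
⊕⟨⟩-deletionClosed c {G = G} {H} sG sH delG delH (right b) =
  realisation-SesquiOrEmpty (⊕⟨⟩-SesquiOrEmpty c (inj₂ sG) (delH (delete-realisation H b))) (⊕⟨⟩-delete-right c G H b)

oneSum-deletionClosed : ∀ {m n} {G : Graph (suc m)} {H : Graph (suc n)} (u : Fin (suc m)) (v : Fin (suc n)) →
                        Sesqui G → Sesqui H → DeletionClosed G → DeletionClosed H →
                        ∀ {y k} {K : Graph k} → SplitView (suc m) n y → Realisation (adj (oneSum G u H v)) y K →
                        SesquiOrEmpty K
oneSum-deletionClosed {G = G} {H} u v sG sH delG delH (left a) with a ≟ u
... | yes refl = realisation-SesquiOrEmpty
  (⊕⟨⟩-SesquiOrEmpty false (delG (delete-realisation G a)) (delH (delete-realisation H v))) (oneSum-delete-glued G a H v)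
... | no a≢u = off-glue a≢u delG
  where
  off-glue : ∀ {m} {G : Graph (suc m)} {u a : Fin (suc m)} → a ≢ u → DeletionClosed G →
             ∀ {k} {K : Graph k} → Realisation (adj (oneSum G u H v)) (a ↑ˡ _) K → SesquiOrEmpty K
  off-glue {zero} {u = zero} {zero} a≢u = contradiction refl a≢u
  off-glue {suc m} {G} {u} {a} a≢u delG = realisation-SesquiOrEmpty
    (inj₂ (sum₁ (punchOut a≢u) v (nonempty-Sesqui (delG (delete-realisation G a))) sH)) (oneSum-delete-left G u H v a a≢u)
oneSum-deletionClosed {G = G} {H} u v sG sH delG delH (right l) = realisation-SesquiOrEmpty
  (inj₂ (sum₁ u _ sG (nonempty-Sesqui (delH (delete-realisation H (punchIn v l)))))) (oneSum-delete-right G u H v l)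

sesqui-deletionClosed : ∀ {N} {G : Graph N} → Sesqui G → DeletionClosed G
sesqui-deletionClosed k₁ r = inj₁ (suc-injective (size r))
sesqui-deletionClosed (iso s G′≅G) r = sesqui-deletionClosed s (≅-realisation-delete G′≅G r)
sesqui-deletionClosed (sum₀ {m} {n} s t) {y} = ⊕⟨⟩-deletionClosed false s t
  (sesqui-deletionClosed s) (sesqui-deletionClosed t) (splitView m n y)
sesqui-deletionClosed (joinS {m} {n} s t) {y} = ⊕⟨⟩-deletionClosed true s t
  (sesqui-deletionClosed s) (sesqui-deletionClosed t) (splitView m n y)
sesqui-deletionClosed (sum₁ {m} {n} u v s t) {y} = oneSum-deletionClosed u v s t
  (sesqui-deletionClosed s) (sesqui-deletionClosed t) (splitView (suc m) n y)

-- Contracting an edge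

module _ (c : Bool) {m n : ℕ} where

  ⊕⟨⟩-contract-left : (G : Graph (suc m)) (H : Graph n) (x y : Fin (suc m)) →
                      Realisation (contractAdj (G ⊕⟨ c ⟩ H) (x ↑ˡ n) (y ↑ˡ n)) (y ↑ˡ n) (contract G x y ⊕⟨ c ⟩ H)
  ⊕⟨⟩-contract-left G H x y = realisation-via-sums S Q f (λ _ _ → refl)
    (⊕⟨⟩-contractAdj-join c G H (inj₁ x) (inj₁ y)) refl
    (⊎-map-injective (punchIn-injective y _ _) id) (⊎-map-avoids₁ (punchInᵢ≢i y)) formula
    where
    A Q : BoolRel (Fin (suc m) ⊎ Fin n)
    A = adj⊎ c G H
    Q = contractRel _≟⊎_ A (inj₁ x) (inj₁ y)
    S : BoolRel (Fin m ⊎ Fin n)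
    S = adj⊎ c (contract G x y) H
    f : Fin m ⊎ Fin n → Fin (suc m) ⊎ Fin n
    f = Sum.map (punchIn y) id
    Qf-sym : ∀ r s → Q (f r) (f s) ≡ Q (f s) (f r)
    Qf-sym r s = contractRel-sym _≟⊎_ A (inj₁ x) (inj₁ y) (adj⊎-sym c G H) (f r) (f s)
    formula : ∀ r s → r ≢ s → S r s ≡ Q (f r) (f s)
    formula (inj₁ a) (inj₁ b) a≢b =
      contract-embed _≟⊎_ G x y {B = A} inj₁-injective (λ _ _ → refl) a b (a≢b ∘ cong inj₁)
    formula (inj₁ a) (inj₂ b) _ =
      sym (contractRel-uniformˡ _≟⊎_ A (inj₁ x) (inj₁ y) (inj₁ (punchIn y a)) (inj₂ b) (λ ()) refl refl refl)
    formula (inj₂ a) (inj₁ b) _ =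
      flip-≡ (adj⊎-sym c (contract G x y) H) Qf-sym (inj₁ b) (inj₂ a) (formula (inj₁ b) (inj₂ a) λ ())
    formula (inj₂ a) (inj₂ b) _ =
      sym (contractRel-unmerged _≟⊎_ A (inj₁ x) (inj₁ y) (inj₂ a) (inj₂ b) (λ ()) (λ ()))

  ⊕⟨⟩-contract-right : (G : Graph m) (H : Graph (suc n)) (x y : Fin (suc n)) →
                       Realisation (contractAdj (G ⊕⟨ c ⟩ H) (m ↑ʳ x) (m ↑ʳ y)) (m ↑ʳ y) (G ⊕⟨ c ⟩ contract H x y)
  ⊕⟨⟩-contract-right G H x y = realisation-via-sums S Q f (λ _ _ → refl)
    (⊕⟨⟩-contractAdj-join c G H (inj₂ x) (inj₂ y)) (sym (+-suc m n))
    (⊎-map-injective id (punchIn-injective y _ _)) (⊎-map-avoids₂ (punchInᵢ≢i y)) formula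
    where
    A Q : BoolRel (Fin m ⊎ Fin (suc n))
    A = adj⊎ c G H
    Q = contractRel _≟⊎_ A (inj₂ x) (inj₂ y)
    S : BoolRel (Fin m ⊎ Fin n)
    S = adj⊎ c G (contract H x y)
    f : Fin m ⊎ Fin n → Fin m ⊎ Fin (suc n)
    f = Sum.map id (punchIn y)
    Qf-sym : ∀ r s → Q (f r) (f s) ≡ Q (f s) (f r)
    Qf-sym r s = contractRel-sym _≟⊎_ A (inj₂ x) (inj₂ y) (adj⊎-sym c G H) (f r) (f s)
    formula : ∀ r s → r ≢ s → S r s ≡ Q (f r) (f s)
    formula (inj₁ a) (inj₁ b) _ =
      sym (contractRel-unmerged _≟⊎_ A (inj₂ x) (inj₂ y) (inj₁ a) (inj₁ b) (λ ()) (λ ()))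
    formula (inj₁ a) (inj₂ b) _ =
      flip-≡ (adj⊎-sym c G (contract H x y)) Qf-sym (inj₂ b) (inj₁ a) (formula (inj₂ b) (inj₁ a) λ ())
    formula (inj₂ a) (inj₁ b) _ =
      sym (contractRel-uniformˡ _≟⊎_ A (inj₂ x) (inj₂ y) (inj₂ (punchIn y a)) (inj₁ b) (λ ()) refl refl refl)
    formula (inj₂ a) (inj₂ b) a≢b =
      contract-embed _≟⊎_ H x y {B = A} inj₂-injective (λ _ _ → refl) a b (a≢b ∘ cong inj₂)

module _ {m n : ℕ} (G : Graph (suc m)) (H : Graph (suc n)) (x : Fin (suc m)) (y : Fin (suc n)) where

  join-contract-across : Realisation (contractAdj (G ⊕⟨ true ⟩ H) (x ↑ˡ suc n) (suc m ↑ʳ y)) (suc m ↑ʳ y)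
                                     (K₁ ⊕⟨ true ⟩ (delete G x ⊕⟨ true ⟩ delete H y))
  join-contract-across = realisation-via-sums S Q f (λ _ _ → refl)
    (⊕⟨⟩-contractAdj-join true G H (inj₁ x) (inj₂ y)) (cong suc (sym (+-suc m n)))
    f-injective f-avoids formula
    where
    A Q : BoolRel (Fin (suc m) ⊎ Fin (suc n))
    A = adj⊎ true G H
    Q = contractRel _≟⊎_ A (inj₁ x) (inj₂ y)
    S : BoolRel (Fin 1 ⊎ Fin (m + n))
    S = adj⊎ true K₁ (delete G x ⊕⟨ true ⟩ delete H y)
    g : Fin m ⊎ Fin n → Fin (suc m) ⊎ Fin (suc n)
    g = Sum.map (punchIn x) (punchIn y)
    f : Fin 1 ⊎ Fin (m + n) → Fin (suc m) ⊎ Fin (suc n)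
    f (inj₁ _) = inj₁ x
    f (inj₂ p) = g (splitAt m p)
    g-avoids-x : ∀ r → g r ≢ inj₁ x
    g-avoids-x = ⊎-map-avoids₁ (punchInᵢ≢i x)
    f-injective : Injective _≡_ _≡_ f
    f-injective {inj₁ zero} {inj₁ zero} _ = refl
    f-injective {inj₁ _} {inj₂ q} e = contradiction (sym e) (g-avoids-x (splitAt m q))
    f-injective {inj₂ p} {inj₁ _} e = contradiction e (g-avoids-x (splitAt m p))
    f-injective {inj₂ p} {inj₂ q} e =
      cong inj₂ (splitAt-injective m n (⊎-map-injective (punchIn-injective x _ _) (punchIn-injective y _ _) e))
    f-avoids : ∀ r → f r ≢ inj₂ y
    f-avoids (inj₁ _) ()
    f-avoids (inj₂ p) = ⊎-map-avoids₂ (punchInᵢ≢i y) (splitAt m p)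
    merged-sees-all : ∀ r → A (inj₁ x) (g r) ∨ A (inj₂ y) (g r) ≡ true
    merged-sees-all (inj₁ a) = ∨-zeroʳ (adj G x (punchIn x a))
    merged-sees-all (inj₂ b) = refl
    formula : ∀ r s → r ≢ s → S r s ≡ Q (f r) (f s)
    formula (inj₁ zero) (inj₁ zero) r≢s = contradiction refl r≢s
    formula (inj₁ zero) (inj₂ p) _ = sym (trans
      (contractRel-merged _≟⊎_ A (inj₁ x) (inj₂ y) (f (inj₂ p)) (g-avoids-x (splitAt m p)))
      (merged-sees-all (splitAt m p)))
    formula (inj₂ p) (inj₁ zero) _ = flip-≡ (adj⊎-sym true K₁ (delete G x ⊕⟨ true ⟩ delete H y))
      (λ r s → contractRel-sym _≟⊎_ A (inj₁ x) (inj₂ y) (adj⊎-sym true G H) (f r) (f s))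
      (inj₁ zero) (inj₂ p) (formula (inj₁ zero) (inj₂ p) λ ())
    formula (inj₂ p) (inj₂ q) _ = trans (adj⊎-map true (λ _ _ → refl) (λ _ _ → refl) (splitAt m p) (splitAt m q))
      (sym (contractRel-unmerged _≟⊎_ A (inj₁ x) (inj₂ y) (f (inj₂ p)) (f (inj₂ q))
        (g-avoids-x (splitAt m p)) (g-avoids-x (splitAt m q))))

module _ {m n : ℕ} (G : Graph (suc (suc m))) (u : Fin (suc (suc m))) (H : Graph (suc n)) (v : Fin (suc n))
         {x y : Fin (suc (suc m))} (x≢y : x ≢ y) where

  oneSum-contract-left : Realisation (contractAdj (oneSum G u H v) (x ↑ˡ n) (y ↑ˡ n)) (y ↑ˡ n)
                                     (oneSum (contract G x y) (punchOut (merge-≢ {u = u} x≢y)) H v)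
  oneSum-contract-left = realisation-via-sums S Q f (λ _ _ → refl)
    (oneSum-contractAdj-join G u H v (inj₁ x) (inj₁ y)) refl
    (⊎-map-injective (punchIn-injective y _ _) id) (⊎-map-avoids₁ (punchInᵢ≢i y)) formula
    where
    open ≡-Reasoning
    u′ : Fin (suc m)
    u′ = punchOut (merge-≢ {u = u} x≢y)
    A Q : BoolRel (Fin (suc (suc m)) ⊎ Fin n)
    A = adj1 G u H v
    Q = contractRel _≟⊎_ A (inj₁ x) (inj₁ y)
    S : BoolRel (Fin (suc m) ⊎ Fin n)
    S = adj1 (contract G x y) u′ H v
    f : Fin (suc m) ⊎ Fin n → Fin (suc (suc m)) ⊎ Fin n
    f = Sum.map (punchIn y) id
    Qf-sym : ∀ r s → Q (f r) (f s) ≡ Q (f s) (f r)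
    Qf-sym r s = contractRel-sym _≟⊎_ A (inj₁ x) (inj₁ y) (adj1-sym G u H v) (f r) (f s)
    formula : ∀ r s → r ≢ s → S r s ≡ Q (f r) (f s)
    formula (inj₁ a) (inj₁ b) a≢b =
      contract-embed _≟⊎_ G x y {B = A} inj₁-injective (λ _ _ → refl) a b (a≢b ∘ cong inj₁)
    formula (inj₁ a) (inj₂ l) _ = begin
      does (a ≟ u′) ∧ h
        ≡⟨ cong (_∧ h) (punchIn-does-≟ y (punchIn-punchOut _)) ⟨
      does (punchIn y a ≟ merge x y u) ∧ h
        ≡⟨ merge-neighbour h (punchInᵢ≢i y a) ⟨
      (does (punchIn y a ≟ u) ∧ h) ∨ (does (punchIn y a ≟ x) ∧ (does (y ≟ u) ∧ h))
        ≡⟨ contractRel-unmergedʳ _≟⊎_ A (inj₁ x) (inj₁ y) (inj₁ (punchIn y a)) (inj₂ l) (λ ()) ⟨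
      Q (inj₁ (punchIn y a)) (inj₂ l) ∎
      where
      h : Bool
      h = adj H v (punchIn v l)
    formula (inj₂ l) (inj₁ a) _ =
      flip-≡ (adj1-sym (contract G x y) u′ H v) Qf-sym (inj₁ a) (inj₂ l) (formula (inj₁ a) (inj₂ l) λ ())
    formula (inj₂ k) (inj₂ l) _ =
      sym (contractRel-unmerged _≟⊎_ A (inj₁ x) (inj₁ y) (inj₂ k) (inj₂ l) (λ ()) (λ ()))

module _ {n : ℕ} (H : Graph (suc (suc n))) (a : Fin (suc (suc n))) {v w : Fin (suc (suc n))} (w≢v : w ≢ v) where
  open PunchInPair w≢v

  adj-contract-v′ˡ : ∀ j → adj (contract H a w) v′ (punchIn v′ j) ≡ contractAdj H a w v (punchIn v (ι j))
  adj-contract-v′ˡ j = trans (adj-embed (contract-realisation H a w) _ _ (punchInᵢ≢i v′ j ∘ sym))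
    (cong₂ (contractAdj H a w) punchIn-v′ (sym (punchIn-ι j)))

  adj-contract-v′ʳ : ∀ j → adj (contract H a w) (punchIn v′ j) v′ ≡ contractAdj H a w (punchIn v (ι j)) v
  adj-contract-v′ʳ j = trans (adj-embed (contract-realisation H a w) _ _ (punchInᵢ≢i v′ j))
    (cong₂ (contractAdj H a w) (sym (punchIn-ι j)) punchIn-v′)

  adj-contract-ι : ∀ j j′ → j ≢ j′ → adj (contract H a w) (punchIn v′ j) (punchIn v′ j′) ≡
                                      contractAdj H a w (punchIn v (ι j)) (punchIn v (ι j′))
  adj-contract-ι j j′ j≢j′ = trans (adj-embed (contract-realisation H a w) _ _ (j≢j′ ∘ punchIn-injective v′ _ _))
    (cong₂ (contractAdj H a w) (sym (punchIn-ι j)) (sym (punchIn-ι j′)))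

module _ {m n : ℕ} (G : Graph (suc m)) (u : Fin (suc m)) (H : Graph (suc (suc n))) (v : Fin (suc (suc n))) where
  private
    A : BoolRel (Fin (suc m) ⊎ Fin (suc n))
    A = adj1 G u H v

  oneSum-contract-right : (kx ky : Fin (suc n)) →
    Realisation (contractAdj (oneSum G u H v) (suc m ↑ʳ kx) (suc m ↑ʳ ky)) (suc m ↑ʳ ky)
                (oneSum G u (contract H (punchIn v kx) (punchIn v ky)) (PunchInPair.v′ (punchInᵢ≢i v ky)))
  oneSum-contract-right kx ky = realisation-via-sums S Q f (λ _ _ → refl)
    (oneSum-contractAdj-join G u H v (inj₂ kx) (inj₂ ky)) (sym (+-suc (suc m) n))
    (⊎-map-injective id ι-injective) (⊎-map-avoids₂ (λ j → punchIn-ι-avoids j ∘ cong (punchIn v))) formula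
    where
    open PunchInPair (punchInᵢ≢i v ky)
    open ≡-Reasoning
    a b : Fin (suc (suc n))
    a = punchIn v kx
    b = punchIn v ky
    S : BoolRel (Fin (suc m) ⊎ Fin n)
    S = adj1 G u (contract H a b) v′
    Q : BoolRel (Fin (suc m) ⊎ Fin (suc n))
    Q = contractRel _≟⊎_ A (inj₂ kx) (inj₂ ky)
    f : Fin (suc m) ⊎ Fin n → Fin (suc m) ⊎ Fin (suc n)
    f = Sum.map id ι
    Qf-sym : ∀ r s → Q (f r) (f s) ≡ Q (f s) (f r)
    Qf-sym r s = contractRel-sym _≟⊎_ A (inj₂ kx) (inj₂ ky) (adj1-sym G u H v) (f r) (f s)
    formula : ∀ r s → r ≢ s → S r s ≡ Q (f r) (f s)
    formula (inj₁ c) (inj₁ d) _ =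
      sym (contractRel-unmerged _≟⊎_ A (inj₂ kx) (inj₂ ky) (inj₁ c) (inj₁ d) (λ ()) (λ ()))
    formula (inj₂ j) (inj₁ c) _ = begin
      does (c ≟ u) ∧ adj (contract H a b) (punchIn v′ j) v′
        ≡⟨ cong (does (c ≟ u) ∧_) (trans (adj-contract-v′ʳ H a (punchInᵢ≢i v ky) j)
             (contractRel-unmergedʳ _≟_ (adj H) a b _ v (punchInᵢ≢i v kx ∘ sym))) ⟩
      does (c ≟ u) ∧ (adj H (punchIn v (ι j)) v ∨ (does (punchIn v (ι j) ≟ a) ∧ adj H b v))
        ≡⟨ cong (λ t → does (c ≟ u) ∧ (adj H (punchIn v (ι j)) v ∨ (t ∧ adj H b v)))
                (does-≟-injective _≟_ _≟_ (punchIn-injective v _ _) (ι j) kx) ⟩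
      does (c ≟ u) ∧ (adj H (punchIn v (ι j)) v ∨ (does (ι j ≟ kx) ∧ adj H b v))
        ≡⟨ ∧-distribˡ-∨-∧ (does (c ≟ u)) (adj H (punchIn v (ι j)) v) (does (ι j ≟ kx)) (adj H b v) ⟩
      (does (c ≟ u) ∧ adj H (punchIn v (ι j)) v) ∨ (does (ι j ≟ kx) ∧ (does (c ≟ u) ∧ adj H b v))
        ≡⟨ contractRel-unmergedʳ _≟⊎_ A (inj₂ kx) (inj₂ ky) (inj₂ (ι j)) (inj₁ c) (λ ()) ⟨
      Q (inj₂ (ι j)) (inj₁ c) ∎
    formula (inj₁ c) (inj₂ j) _ =
      flip-≡ (adj1-sym G u (contract H a b) v′) Qf-sym (inj₂ j) (inj₁ c) (formula (inj₂ j) (inj₁ c) λ ())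
    formula (inj₂ j) (inj₂ j′) r≢s = begin
      adj (contract H a b) (punchIn v′ j) (punchIn v′ j′)
        ≡⟨ adj-contract-ι H a (punchInᵢ≢i v ky) j j′ (r≢s ∘ cong inj₂) ⟩
      contractAdj H a b (punchIn v (ι j)) (punchIn v (ι j′))
        ≡⟨ contractRel-embed _≟_ _≟_ {B = adj H} (punchIn-injective v _ _) (λ _ _ → refl) kx ky (ι j) (ι j′) ⟩
      contractRel _≟_ (adj (delete H v)) kx ky (ι j) (ι j′)
        ≡⟨ contractRel-embed _≟_ _≟⊎_ {B = A} inj₂-injective (λ _ _ → refl) kx ky (ι j) (ι j′) ⟨
      Q (inj₂ (ι j)) (inj₂ (ι j′)) ∎

  oneSum-contract-glued : (l : Fin (suc n)) →
    Realisation (contractAdj (oneSum G u H v) (u ↑ˡ suc n) (suc m ↑ʳ l)) (suc m ↑ʳ l)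
                (oneSum G u (contract H v (punchIn v l)) (PunchInPair.v′ (punchInᵢ≢i v l)))
  oneSum-contract-glued l = realisation-via-sums S Q f (λ _ _ → refl)
    (oneSum-contractAdj-join G u H v (inj₁ u) (inj₂ l)) (sym (+-suc (suc m) n))
    (⊎-map-injective id ι-injective) (⊎-map-avoids₂ (λ j → punchIn-ι-avoids j ∘ cong (punchIn v))) formula
    where
    open PunchInPair (punchInᵢ≢i v l)
    open ≡-Reasoning
    w : Fin (suc (suc n))
    w = punchIn v l
    S : BoolRel (Fin (suc m) ⊎ Fin n)
    S = adj1 G u (contract H v w) v′
    Q : BoolRel (Fin (suc m) ⊎ Fin (suc n))
    Q = contractRel _≟⊎_ A (inj₁ u) (inj₂ l)
    f : Fin (suc m) ⊎ Fin n → Fin (suc m) ⊎ Fin (suc n)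
    f = Sum.map id ι
    Qf-sym : ∀ r s → Q (f r) (f s) ≡ Q (f s) (f r)
    Qf-sym r s = contractRel-sym _≟⊎_ A (inj₁ u) (inj₂ l) (adj1-sym G u H v) (f r) (f s)
    formula : ∀ r s → r ≢ s → S r s ≡ Q (f r) (f s)
    formula (inj₁ c) (inj₁ d) r≢s = sym (trans
      (cong (adj G c d ∨_) (cong₂ _∨_ (does-≟-disjoint u _ c≢d) (does-≟-disjoint u _ (c≢d ∘ sym))))
      (∨-identityʳ (adj G c d)))
      where
      c≢d : c ≢ d
      c≢d = r≢s ∘ cong inj₁
    formula (inj₁ c) (inj₂ j) _ = begin
      does (c ≟ u) ∧ adj (contract H v w) v′ (punchIn v′ j)
        ≡⟨ cong (does (c ≟ u) ∧_) (trans (adj-contract-v′ˡ H v (punchInᵢ≢i v l) j)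
             (contractRel-merged _≟_ (adj H) v w _ (punchInᵢ≢i v (ι j)))) ⟩
      does (c ≟ u) ∧ (adj H v (punchIn v (ι j)) ∨ adj H w (punchIn v (ι j)))
        ≡⟨ ∧-distribˡ-∨ (does (c ≟ u)) _ _ ⟩
      (does (c ≟ u) ∧ adj H v (punchIn v (ι j))) ∨ (does (c ≟ u) ∧ adj H w (punchIn v (ι j)))
        ≡⟨ contractRel-unmergedʳ _≟⊎_ A (inj₁ u) (inj₂ l) (inj₁ c) (inj₂ (ι j)) (λ ()) ⟨
      Q (inj₁ c) (inj₂ (ι j)) ∎
    formula (inj₂ j) (inj₁ c) _ =
      flip-≡ (adj1-sym G u (contract H v w) v′) Qf-sym (inj₁ c) (inj₂ j) (formula (inj₁ c) (inj₂ j) λ ())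
    formula (inj₂ j) (inj₂ j′) r≢s = begin
      adj (contract H v w) (punchIn v′ j) (punchIn v′ j′)
        ≡⟨ adj-contract-ι H v (punchInᵢ≢i v l) j j′ (r≢s ∘ cong inj₂) ⟩
      contractAdj H v w (punchIn v (ι j)) (punchIn v (ι j′))
        ≡⟨ contractRel-unmerged _≟_ (adj H) v w _ _ (punchInᵢ≢i v (ι j)) (punchInᵢ≢i v (ι j′)) ⟩
      adj H (punchIn v (ι j)) (punchIn v (ι j′))
        ≡⟨ contractRel-unmerged _≟⊎_ A (inj₁ u) (inj₂ l) (inj₂ (ι j)) (inj₂ (ι j′)) (λ ()) (λ ()) ⟨
      Q (inj₂ (ι j)) (inj₂ (ι j′)) ∎

ContractionClosed : ∀ {N} → Graph N → Set
ContractionClosed {N} G =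
  ∀ {x y : Fin N} {k} {K : Graph k} → adj G x y ≡ true → Realisation (contractAdj G x y) y K → Sesqui K

join-contractionClosed-across : ∀ {m n} {G : Graph (suc m)} {H : Graph (suc n)} → Sesqui G → Sesqui H →
  ∀ x y {k} {K : Graph k} →
  Realisation (contractAdj (G ⊕⟨ true ⟩ H) (x ↑ˡ suc n) (suc m ↑ʳ y)) (suc m ↑ʳ y) K → Sesqui K
join-contractionClosed-across {G = G} {H} sG sH x y = realisation-Sesqui
  (nonempty-Sesqui (⊕⟨⟩-SesquiOrEmpty true (inj₂ k₁) (⊕⟨⟩-SesquiOrEmpty true
    (sesqui-deletionClosed sG (delete-realisation G x)) (sesqui-deletionClosed sH (delete-realisation H y)))))
  (join-contract-across G H x y)

⊕⟨⟩-contractionClosed : ∀ c {m n} {G : Graph m} {H : Graph n} → Sesqui G → Sesqui H →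
                        ContractionClosed G → ContractionClosed H →
                        ∀ {x y k} {K : Graph k} → SplitView m n x → SplitView m n y →
                        adj (G ⊕⟨ c ⟩ H) x y ≡ true → Realisation (contractAdj (G ⊕⟨ c ⟩ H) x y) y K → Sesqui K
⊕⟨⟩-contractionClosed c {G = G} {H} sG sH conG conH (left a) (left b) e = realisation-Sesqui
  (Sesqui-⊕⟨⟩ c (conG (⊕⟨⟩-edge c G H (inj₁ a) (inj₁ b) e)
                       (contract-realisation G a b)) sH)
  (⊕⟨⟩-contract-left c G H a b)
⊕⟨⟩-contractionClosed c {G = G} {H} sG sH conG conH (right a) (right b) e = realisation-Sesqui
  (Sesqui-⊕⟨⟩ c sG (conH (⊕⟨⟩-edge c G H (inj₂ a) (inj₂ b) e)
                          (contract-realisation H a b)))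
  (⊕⟨⟩-contract-right c G H a b)
⊕⟨⟩-contractionClosed false {G = G} {H} _ _ _ _ (left a) (right b) e =
  contradiction (⊕⟨⟩-edge false G H (inj₁ a) (inj₂ b) e) λ ()
⊕⟨⟩-contractionClosed false {G = G} {H} _ _ _ _ (right a) (left b) e =
  contradiction (⊕⟨⟩-edge false G H (inj₂ a) (inj₁ b) e) λ ()
⊕⟨⟩-contractionClosed true sG sH _ _ (left a) (right b) e = join-contractionClosed-across sG sH a b
⊕⟨⟩-contractionClosed true {G = G} {H} sG sH _ _ (right b) (left a) e =
  join-contractionClosed-across sG sH a b ∘ contract-swap (G ⊕⟨ true ⟩ H) (adjacent-≢ (G ⊕⟨ true ⟩ H) e)

oneSum-contractionClosed-glued : ∀ {m n} {G : Graph (suc m)} {H : Graph (suc (suc n))} (u : Fin (suc m)) v →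
  Sesqui G → ContractionClosed H → ∀ a l → adj (oneSum G u H v) (a ↑ˡ suc n) (suc m ↑ʳ l) ≡ true →
  ∀ {k} {K : Graph k} → Realisation (contractAdj (oneSum G u H v) (a ↑ˡ suc n) (suc m ↑ʳ l)) (suc m ↑ʳ l) K → Sesqui K
oneSum-contractionClosed-glued {G = G} {H} u v sG conH a l e with a ≟ u | oneSum-edge G u H v (inj₁ a) (inj₂ l) e
... | yes refl | vw-edge = realisation-Sesqui
  (sum₁ u _ sG (conH vw-edge (contract-realisation H v (punchIn v l)))) (oneSum-contract-glued G u H v l)
... | no _ | ()

oneSum-contractionClosed : ∀ {m n} {G : Graph (suc m)} {H : Graph (suc n)} (u : Fin (suc m)) (v : Fin (suc n)) →
                           Sesqui G → Sesqui H → ContractionClosed G → ContractionClosed H →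
                           ∀ {x y k} {K : Graph k} → SplitView (suc m) n x → SplitView (suc m) n y →
                           adj (oneSum G u H v) x y ≡ true →
                           Realisation (contractAdj (oneSum G u H v) x y) y K → Sesqui K
oneSum-contractionClosed {zero} {n} {G = G} {H} u v _ _ _ _ (left zero) (left zero) e =
  contradiction refl (adjacent-≢ (oneSum G u H v) {zero ↑ˡ n} {zero ↑ˡ n} e)
oneSum-contractionClosed {suc m} {G = G} {H} u v _ sH conG _ (left a) (left b) e = realisation-Sesqui
  (sum₁ _ v (conG ab-edge (contract-realisation G a b)) sH) (oneSum-contract-left G u H v (adjacent-≢ G ab-edge))
  where
  ab-edge : adj G a b ≡ true
  ab-edge = oneSum-edge G u H v (inj₁ a) (inj₁ b) e
oneSum-contractionClosed u v sG _ _ conH (left a) (right l) e = oneSum-contractionClosed-glued u v sG conH a l e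
oneSum-contractionClosed {m} {G = G} {H} u v sG _ _ conH (right l) (left a) e =
  oneSum-contractionClosed-glued u v sG conH a l (trans (adj-sym (oneSum G u H v) (a ↑ˡ _) (suc m ↑ʳ l)) e)
  ∘ contract-swap (oneSum G u H v) (adjacent-≢ (oneSum G u H v) e)
oneSum-contractionClosed {G = G} {H} u v sG _ _ conH (right k) (right l) e = realisation-Sesqui
  (sum₁ u _ sG (conH (oneSum-edge G u H v (inj₂ k) (inj₂ l) e) (contract-realisation H (punchIn v k) (punchIn v l))))
  (oneSum-contract-right G u H v k l)

sesqui-contractionClosed : ∀ {N} {G : Graph N} → Sesqui G → ContractionClosed G
sesqui-contractionClosed k₁ ()
sesqui-contractionClosed (iso s G′≅G) e = sesqui-contractionClosed s (≅-adj G′≅G e) ∘ ≅-realisation-contract G′≅G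
sesqui-contractionClosed (sum₀ {m} {n} s t) {x} {y} = ⊕⟨⟩-contractionClosed false s t
  (sesqui-contractionClosed s) (sesqui-contractionClosed t) (splitView m n x) (splitView m n y)
sesqui-contractionClosed (joinS {m} {n} s t) {x} {y} = ⊕⟨⟩-contractionClosed true s t
  (sesqui-contractionClosed s) (sesqui-contractionClosed t) (splitView m n x) (splitView m n y)
sesqui-contractionClosed (sum₁ {m} {n} u v s t) {x} {y} = oneSum-contractionClosed u v s t
  (sesqui-contractionClosed s) (sesqui-contractionClosed t) (splitView (suc m) n x) (splitView (suc m) n y)

proposition2p6 : {n : ℕ} (G : Graph (suc n)) → Sesqui G →
                 (x y : Fin (suc n)) → adj G x y ≡ true →
                 Sesqui (contract G x y)
proposition2p6 G s x y e = sesqui-contractionClosed s e (contract-realisation G x y)
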